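{- Let $G$ be a profinite subgroup of $S_\infty$ and let $\alpha(\bar x)$ be a quantifier-free formula in the language of groups. Then for every tuple $\bar g$ of elements of $G$, $G\models\alpha(\bar g)$ if and only if $G_k\models\alpha(\bar g_k)$ for all sufficiently large $k\in\mathbb{N}$.
   Context: $S_\infty$ is the group of all permutations of $\mathbb{N}$, with the topology of pointwise convergence; its profinite subgroups are exactly the closed subgroups all of whose orbits $\mathrm{orb}_G(n)=\{g(n):g\in G\}$ are finite. The orbits of a profinite $G$ are enumerated as $O_{G,0}=\mathrm{orb}_G(0)$ and $O_{G,n+1}=$ the orbit of the least natural number not in any $O_{G,m}$, $m\le n$. For $g\in G$ and $k\in\mathbb{N}$, $g_k=g\restriction\bigcup_{i\le k}O_{G,i}$ (applied coordinatewise to tuples), and $G_k=\{g_k:g\in G\}$, a finite group under composition. -}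

module Defs where

open import Level using (0ℓ)
open import Data.Nat using (ℕ; zero; suc; _≤_; _<_)
open import Data.Fin using (Fin)
open import Data.Product using (Σ; ∃-syntax; _×_; _,_; proj₁; proj₂)
open import Data.Empty using (⊥)
open import Data.Unit using (⊤)
open import Data.Sum using (_⊎_)
open import Relation.Nullary using (¬_)
open import Relation.Unary using (Pred)
open import Relation.Binary.PropositionalEquality using (_≡_)
open import Function using (_∘_; id)
open import Function.Bundles using (_↔_; Inverse)
open import Function.Construct.Identity using (↔-id)
open import Function.Construct.Symmetry using (↔-sym)
open import Function.Construct.Composition using (_↔-∘_)

Perm : Set
Perm = ℕ ↔ ℕ

_≈ₚ_ : Perm → Perm → Set
f ≈ₚ g = ∀ n → Inverse.to f n ≡ Inverse.to g n

-- group operations of S_∞ : (g · h)(n) = g (h n)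
idₚ : Perm
idₚ = ↔-id ℕ

_·ₚ_ : Perm → Perm → Perm
g ·ₚ h = g ↔-∘ h

invₚ : Perm → Perm
invₚ = ↔-sym

record IsSubgroup (G : Pred Perm 0ℓ) : Set where
  field
    resp : ∀ {f g} → f ≈ₚ g → G f → G g
    id∈  : G idₚ
    ·∈   : ∀ {f g} → G f → G g → G (f ·ₚ g)
    inv∈ : ∀ {f} → G f → G (invₚ f)

-- closed in the topology of pointwise convergence: every permutation
-- all of whose finite restrictions are matched by elements of G lies in G
IsClosed : Pred Perm 0ℓ → Set
IsClosed G = ∀ (f : Perm) →
  (∀ n → ∃[ g ] (G g × (∀ i → i < n → Inverse.to g i ≡ Inverse.to f i))) → G f

orb : Pred Perm 0ℓ → ℕ → ℕ → Set
orb G n m = ∃[ g ] (G g × Inverse.to g n ≡ m)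

-- every orbit is finite (a subset of ℕ is finite iff it is bounded)
FiniteOrbits : Pred Perm 0ℓ → Set
FiniteOrbits G = ∀ n → ∃[ b ] (∀ m → orb G n m → m < b)

IsProfinite : Pred Perm 0ℓ → Set
IsProfinite G = IsSubgroup G × IsClosed G × FiniteOrbits G

-- Enumeration of orbits: r j is the representative of O_{G,j}, i.e.
-- O_{G,j} = orb_G(r j), with r 0 = 0 and r (j+1) the least natural
-- number not in any O_{G,i}, i ≤ j.

IsOrbitReps : Pred Perm 0ℓ → (ℕ → ℕ) → Set
IsOrbitReps G r =
  r 0 ≡ 0 ×
  (∀ j → (¬ (∃[ i ] (i ≤ j × orb G (r i) (r (suc j))))) ×
         (∀ m → m < r (suc j) → ∃[ i ] (i ≤ j × orb G (r i) m)))

InU : Pred Perm 0ℓ → (ℕ → ℕ) → ℕ → ℕ → Set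
InU G r k m = ∃[ i ] (i ≤ k × orb G (r i) m)

data Term (n : ℕ) : Set where
  var  : Fin n → Term n
  e    : Term n
  _∙_  : Term n → Term n → Term n
  _⁻¹  : Term n → Term n

data QF (n : ℕ) : Set where
  _≐_  : Term n → Term n → QF n
  ⊤'   : QF n
  ⊥'   : QF n
  ¬'_  : QF n → QF n
  _∧'_ : QF n → QF n → QF n
  _∨'_ : QF n → QF n → QF n
  _⇒'_ : QF n → QF n → QF n

record GroupStr : Set₁ where
  field
    Carrier : Set
    _≈_     : Carrier → Carrier → Set
    one     : Carrier
    mul     : Carrier → Carrier → Carrier
    inv     : Carrier → Carrier

module _ (M : GroupStr) where
  open GroupStr M

  evalT : ∀ {n} → Term n → (Fin n → Carrier) → Carrier
  evalT (var i) a = a i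
  evalT e       a = one
  evalT (t ∙ s) a = mul (evalT t a) (evalT s a)
  evalT (t ⁻¹)  a = inv (evalT t a)

  Sat : ∀ {n} → QF n → (Fin n → Carrier) → Set
  Sat (t ≐ s)  a = evalT t a ≈ evalT s a
  Sat ⊤'       a = ⊤
  Sat ⊥'       a = ⊥
  Sat (¬' φ)   a = ¬ Sat φ a
  Sat (φ ∧' ψ) a = Sat φ a × Sat ψ a
  Sat (φ ∨' ψ) a = Sat φ a ⊎ Sat ψ a
  Sat (φ ⇒' ψ) a = Sat φ a → Sat ψ a

GStr : GroupStr
GStr = record { Carrier = Perm ; _≈_ = _≈ₚ_ ; one = idₚ ; mul = _·ₚ_ ; inv = invₚ }

-- The finite group G_k = { g_k : g ∈ G }, g_k = g ↾ U_k with
-- U_k = ⋃_{i ≤ k} O_{G,i}.  An element g_k is represented by the pair of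
-- maps (g, g⁻¹) regarded only on U_k: two elements are equal iff their
-- first maps agree on U_k; the product is composition of maps and the
-- inverse of g_k is g⁻¹ ↾ U_k.
GkStr : Pred Perm 0ℓ → (ℕ → ℕ) → ℕ → GroupStr
GkStr G r k = record
  { Carrier = (ℕ → ℕ) × (ℕ → ℕ)
  ; _≈_     = λ x y → ∀ m → InU G r k m → proj₁ x m ≡ proj₁ y m
  ; one     = id , id
  ; mul     = λ x y → (proj₁ x ∘ proj₁ y) , (proj₂ y ∘ proj₂ x)
  ; inv     = λ x → proj₂ x , proj₁ x
  }

restrict : Perm → (ℕ → ℕ) × (ℕ → ℕ)
restrict g = Inverse.to g , Inverse.from g

{-# OPTIONS --safe #-}

-- Every term evaluates in G_k to the restriction of its value in G, so an atom
-- t ≐ s holds in G_k iff the permutations t(ḡ) and s(ḡ) agree on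
-- U_k = ⋃_{i ≤ k} O_{G,i}.  The orbit representatives are strictly increasing,
-- so m ≤ r m and hence m ∈ U_m: the sets U_k increase and exhaust ℕ.  Thus if
-- t(ḡ) and s(ḡ) differ at some m (found by excluded middle), the atom fails in
-- G_k for all k ≥ m, and if they are equal it holds in every G_k.  Atoms are
-- therefore eventually evaluated correctly, and this survives the connectives by
-- taking maxima of thresholds.

module Submission where

open import Defs
open import Level using (0ℓ)
open import Axiom.ExcludedMiddle using (ExcludedMiddle)
open import Axiom.DoubleNegationElimination using (em⇒dne)
open import Data.Nat using (ℕ; zero; suc; _≤_; _<_; _⊔_; z≤n)
open import Data.Nat.Properties
  using (≤-refl; ≤-trans; ≤-<-trans; m≤n⇒m≤1+n; m≤n⇒m<n∨m≡n; m≤m⊔n; m≤n⊔m; ≰⇒>; n≤0⇒n≡0)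
open import Data.Fin using (Fin)
open import Data.Product using (∃-syntax; _,_; proj₁; proj₂)
open import Data.Product.Function.NonDependent.Propositional using (_×-⇔_)
open import Data.Sum using (inj₁; inj₂)
open import Data.Sum.Function.Propositional using (_⊎-⇔_)
open import Data.Empty using (⊥-elim)
open import Function using (_∘_; _⇔_; mk⇔)
open import Function.Bundles using (Inverse; module Equivalence)
open import Function.Construct.Identity using (⇔-id)
open import Function.Construct.Symmetry using (⇔-sym)
open import Function.Construct.Composition using (_⇔-∘_)
open import Function.Related.TypeIsomorphisms using (→-cong-⇔; ¬-cong-⇔)
open import Relation.Unary using (Pred)
open import Relation.Nullary using (¬_; yes; no)
open import Relation.Nullary.Negation using (¬∃⟶∀¬)
open import Relation.Binary.PropositionalEquality using (_≡_; refl; sym; trans; cong; cong₂; subst)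

Eventually : (ℕ → Set) → Set
Eventually P = ∃[ K ] (∀ k → K ≤ k → P k)

eventually-always : ∀ {P} → (∀ k → P k) → Eventually P
eventually-always p = 0 , λ k _ → p k

eventually-map : ∀ {P Q} → (∀ {k} → P k → Q k) → Eventually P → Eventually Q
eventually-map f (K , p) = K , λ k K≤k → f (p k K≤k)

eventually-zipWith : ∀ {P Q R} → (∀ {k} → P k → Q k → R k) →
                     Eventually P → Eventually Q → Eventually R
eventually-zipWith f (K , p) (L , q) = K ⊔ L , λ k K⊔L≤k →
  f (p k (≤-trans (m≤m⊔n K L) K⊔L≤k)) (q k (≤-trans (m≤n⊔m K L) K⊔L≤k))

⇔-eventually : ∀ {A : Set} {B : ℕ → Set} → Eventually (λ k → A ⇔ B k) → A ⇔ Eventually B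
⇔-eventually (K , A⇔B) = mk⇔
  (λ a → K , λ k K≤k → Equivalence.to (A⇔B k K≤k) a)
  (λ { (L , b) → Equivalence.from (A⇔B (K ⊔ L) (m≤m⊔n K L)) (b (K ⊔ L) (m≤n⊔m K L)) })

module _ (M : GroupStr) (N : ℕ → GroupStr) {n} (a : Fin n → GroupStr.Carrier M)
         (b : ∀ k → Fin n → GroupStr.Carrier (N k)) where

  Sat-eventually-⇔ :
    (∀ t s → Eventually (λ k → Sat M (t ≐ s) a ⇔ Sat (N k) (t ≐ s) (b k))) →
    ∀ α → Eventually (λ k → Sat M α a ⇔ Sat (N k) α (b k))
  Sat-eventually-⇔ atoms (t ≐ s)  = atoms t s
  Sat-eventually-⇔ atoms ⊤'       = eventually-always λ _ → ⇔-id _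
  Sat-eventually-⇔ atoms ⊥'       = eventually-always λ _ → ⇔-id _
  Sat-eventually-⇔ atoms (¬' φ)   = eventually-map ¬-cong-⇔ (Sat-eventually-⇔ atoms φ)
  Sat-eventually-⇔ atoms (φ ∧' ψ) =
    eventually-zipWith _×-⇔_ (Sat-eventually-⇔ atoms φ) (Sat-eventually-⇔ atoms ψ)
  Sat-eventually-⇔ atoms (φ ∨' ψ) =
    eventually-zipWith _⊎-⇔_ (Sat-eventually-⇔ atoms φ) (Sat-eventually-⇔ atoms ψ)
  Sat-eventually-⇔ atoms (φ ⇒' ψ) =
    eventually-zipWith →-cong-⇔ (Sat-eventually-⇔ atoms φ) (Sat-eventually-⇔ atoms ψ)

module _ (M N : GroupStr) (h : GroupStr.Carrier M → GroupStr.Carrier N)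
         (h-one : h (GroupStr.one M) ≡ GroupStr.one N)
         (h-mul : ∀ x y → h (GroupStr.mul M x y) ≡ GroupStr.mul N (h x) (h y))
         (h-inv : ∀ x → h (GroupStr.inv M x) ≡ GroupStr.inv N (h x)) where

  evalT-homo : ∀ {n} (t : Term n) (a : Fin n → GroupStr.Carrier M) →
               evalT N t (h ∘ a) ≡ h (evalT M t a)
  evalT-homo (var i) a = refl
  evalT-homo e       a = sym h-one
  evalT-homo (t ∙ s) a = trans (cong₂ (GroupStr.mul N) (evalT-homo t a) (evalT-homo s a))
                               (sym (h-mul (evalT M t a) (evalT M s a)))
  evalT-homo (t ⁻¹)  a = trans (cong (GroupStr.inv N) (evalT-homo t a))
                               (sym (h-inv (evalT M t a)))

Exhausts : (ℕ → Pred ℕ 0ℓ) → Set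
Exhausts U = ∀ m → Eventually (λ k → U k m)

∀-eventually-⇔-restricted-∀ : ExcludedMiddle 0ℓ → {U : ℕ → Pred ℕ 0ℓ} → Exhausts U →
  (Q : Pred ℕ 0ℓ) → Eventually (λ k → (∀ m → Q m) ⇔ (∀ m → U k m → Q m))
∀-eventually-⇔-restricted-∀ em {U} exhausts Q with em {∃[ m ] ¬ Q m}
... | yes (m , ¬Qm) = eventually-map bothFalse (exhausts m)
  where
  bothFalse : ∀ {k} → U k m → (∀ m → Q m) ⇔ (∀ m → U k m → Q m)
  bothFalse Ukm = mk⇔ (λ ∀Q → ⊥-elim (¬Qm (∀Q m))) (λ ∀UQ → ⊥-elim (¬Qm (∀UQ m Ukm)))
... | no ¬∃¬Q = eventually-always λ k → mk⇔ (λ _ m _ → ∀Q m) (λ _ → ∀Q)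
  where
  ∀Q : ∀ m → Q m
  ∀Q m = em⇒dne em (¬∃⟶∀¬ ¬∃¬Q m)

InU-mono : ∀ {G r k k′ m} → k ≤ k′ → InU G r k m → InU G r k′ m
InU-mono k≤k′ (i , i≤k , m∈Oᵢ) = i , ≤-trans i≤k k≤k′ , m∈Oᵢ

module _ {G : Pred Perm 0ℓ} (id∈G : G idₚ) {r : ℕ → ℕ} (reps : IsOrbitReps G r) where

  ≡⇒orb : ∀ {n m} → n ≡ m → orb G n m
  ≡⇒orb n≡m = idₚ , id∈G , n≡m

  ≤-rep⇒InU : ∀ j {m} → m ≤ r j → InU G r j m
  ≤-rep⇒InU zero m≤r₀ = 0 , z≤n , ≡⇒orb (trans r₀≡0 (sym (n≤0⇒n≡0 (subst (_ ≤_) r₀≡0 m≤r₀))))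
    where r₀≡0 = proj₁ reps
  ≤-rep⇒InU (suc j) m≤rⱼ₊₁ with m≤n⇒m<n∨m≡n m≤rⱼ₊₁
  ... | inj₁ m<rⱼ₊₁ with proj₂ (proj₂ reps j) _ m<rⱼ₊₁
  ...   | i , i≤j , m∈Oᵢ = i , m≤n⇒m≤1+n i≤j , m∈Oᵢ
  ≤-rep⇒InU (suc j) m≤rⱼ₊₁ | inj₂ m≡rⱼ₊₁ = suc j , ≤-refl , ≡⇒orb (sym m≡rⱼ₊₁)

  rep-increasing : ∀ j → r j < r (suc j)
  rep-increasing j = ≰⇒> λ rⱼ₊₁≤rⱼ → proj₁ (proj₂ reps j) (≤-rep⇒InU j rⱼ₊₁≤rⱼ)

  ≤-rep : ∀ j → j ≤ r j
  ≤-rep zero    = z≤n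
  ≤-rep (suc j) = ≤-<-trans (≤-rep j) (rep-increasing j)

  InU-exhausts : Exhausts (InU G r)
  InU-exhausts m = m , λ k m≤k → InU-mono m≤k (≤-rep⇒InU m (≤-rep m))

evalT-restrict : ∀ G r k {n} (t : Term n) (g : Fin n → Perm) →
                 evalT (GkStr G r k) t (restrict ∘ g) ≡ restrict (evalT GStr t g)
evalT-restrict G r k = evalT-homo GStr (GkStr G r k) restrict refl (λ _ _ → refl) (λ _ → refl)

GkStr-≐⇔agree-on-InU : ∀ G r k {n} (t s : Term n) (g : Fin n → Perm) →
  Sat (GkStr G r k) (t ≐ s) (restrict ∘ g) ⇔
  (∀ m → InU G r k m → Inverse.to (evalT GStr t g) m ≡ Inverse.to (evalT GStr s g) m)
GkStr-≐⇔agree-on-InU G r k t s g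
  rewrite evalT-restrict G r k t g | evalT-restrict G r k s g = ⇔-id _

GkStr-atoms-eventually-⇔ : ExcludedMiddle 0ℓ → ∀ {G} → G idₚ → ∀ {r} → IsOrbitReps G r →
  ∀ {n} (t s : Term n) (g : Fin n → Perm) →
  Eventually (λ k → Sat GStr (t ≐ s) g ⇔ Sat (GkStr G r k) (t ≐ s) (restrict ∘ g))
GkStr-atoms-eventually-⇔ em id∈G reps t s g =
  eventually-map (λ {k} agree⇔agreeOnU → ⇔-sym (GkStr-≐⇔agree-on-InU _ _ k t s g) ⇔-∘ agree⇔agreeOnU)
    (∀-eventually-⇔-restricted-∀ em (InU-exhausts id∈G reps)
      (λ m → Inverse.to (evalT GStr t g) m ≡ Inverse.to (evalT GStr s g) m))

lemma3 : ExcludedMiddle 0ℓ →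
    (G : Pred Perm 0ℓ) → IsProfinite G →
    (r : ℕ → ℕ) → IsOrbitReps G r →
    ∀ {n} (α : QF n) (g : Fin n → Perm) → (∀ i → G (g i)) →
    Sat GStr α g ⇔ (∃[ K ] (∀ k → K ≤ k → Sat (GkStr G r k) α (restrict ∘ g)))
lemma3 em G (subgroup , _) r reps α g _ =
  ⇔-eventually (Sat-eventually-⇔ GStr (GkStr G r) g (λ _ → restrict ∘ g)
    (λ t s → GkStr-atoms-eventually-⇔ em (IsSubgroup.id∈ subgroup) reps t s g) α)
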